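{- Let $n\ge 4$ be an integer, $m:=n-2$, and let $a,b$ be non-negative integers with $a+b+1=m$. Put $\zeta_n:=\exp(2\pi\sqrt{ -1}/n)$ and for positive integers $s_1,\dots,s_m$ define $$\mathfrak Z_n(\zeta_n;;s_1,\dots,s_m):=\sum_{1\le i_1<\dots<i_m\le n-1}\frac{1}{(1-\zeta_n^{i_1})^{s_1}\cdots(1-\zeta_n^{i_m})^{s_m}}.$$ Then $$\mathfrak Z_n(\zeta_n;;\underbrace{1,\dots,1}_a,2,\underbrace{1,\dots,1}_b)+\mathfrak Z_n(\zeta_n;;\underbrace{1,\dots,1}_b,2,\underbrace{1,\dots,1}_a)=-\frac{m!\,(n-2m-3)}{(m+2)!}\binom{n-1}{m}.$$ -}

module Defs where

open import Level using (Level; _⊔_)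
open import Data.Nat as ℕ using (ℕ; zero; suc; _<_)
open import Data.List using (List; []; _∷_)
import Data.Product as P
open import Relation.Nullary using (¬_)
open import Algebra.Bundles using (CommutativeRing; Semiring)
import Algebra.Definitions.RawSemiring as RS

-- A field, presented as a (non-trivial) commutative ring together with a
-- total operation _⁻¹ which is a multiplicative inverse on non-zero elements
-- (the value of 0⁻¹ is irrelevant).
record Field (c ℓ : Level) : Set (Level.suc (c ⊔ ℓ)) where
  field
    commutativeRing : CommutativeRing c ℓ
  open CommutativeRing commutativeRing public
  field
    _⁻¹      : Carrier → Carrier
    ⁻¹-inverse : ∀ x → ¬ (x ≈ 0#) → x * (x ⁻¹) ≈ 1#
    0≉1      : ¬ (0# ≈ 1#)
  open RS (Semiring.rawSemiring semiring) public using (_×_; _^_)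

  fromℕ : ℕ → Carrier
  fromℕ k = k × 1#

  CharZero : Set ℓ
  CharZero = ∀ k → ¬ (fromℕ (suc k) ≈ 0#)

  PrimitiveRoot : ℕ → Carrier → Set ℓ
  PrimitiveRoot n ζ = (ζ ^ n ≈ 1#) P.× (∀ k → 0 ℕ.< k → k ℕ.< n → ¬ (ζ ^ k ≈ 1#))

  -- Zgo ζ st cnt (s₁ ∷ … ∷ s_m) =
  --   Σ_{st ≤ i₁ < … < i_m ≤ st + cnt - 1}  Π_j (1 - ζ^{i_j})^{-s_j}
  -- (empty list gives 1; defined by "first index is st or not").
  Zgo : Carrier → ℕ → ℕ → List ℕ → Carrier
  Zgo ζ st cnt       []       = 1#
  Zgo ζ st zero      (s ∷ ss) = 0#
  Zgo ζ st (suc cnt) (s ∷ ss) =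
    (((1# - ζ ^ st) ⁻¹) ^ s) * Zgo ζ (suc st) cnt ss + Zgo ζ (suc st) cnt (s ∷ ss)

  𝔷 : ℕ → Carrier → List ℕ → Carrier
  𝔷 n ζ ss = Zgo ζ 1 (n ℕ.∸ 1) ss

{-# OPTIONS --safe #-}
-- Write y i = (1 - ζ ^ i)⁻¹ and N = n - 1. When all exponents are 1 except one 2, the N - 1
-- indices i₁ < ⋯ < i_{N-1} omit exactly one j ∈ {1, …, N}, so each term is ∏ᵢ y i times
-- (1 - ζ ^ j) times one extra y at the index carrying the 2: the position p = a + 1 of the 2
-- if j lies after it, and p + 1 otherwise. Adding the mirrored sum, the reflection
-- y (n - i) = 1 - y i, ∑ᵢ ζ ^ i = -1 and a telescoping geometric sum reduce the total to
-- N · ∏ᵢ y i. Finally ∏ᵢ (1 - ζ ^ i) = n, because 1 + t + ⋯ + t ^ N is monic with the N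
-- distinct roots ζ ^ i; so the sum is N / n, which is the right-hand side since
-- n - 2m - 3 = -N, (m + 2)! = n N m! and C(N, m) = N.
module Submission where

open import Level using (_⊔_)
open import Data.Nat as ℕ using (ℕ; _≤_; _!; zero; suc; _<_; z≤n; s≤s)
import Data.Nat.Properties as ℕₚ
open import Data.Nat.Solver using (module +-*-Solver)
open import Data.Nat.Combinatorics using (_C_; nCk≡nC[n∸k]; nC1≡n)
open import Data.List using (List; []; _∷_; _++_; replicate; length)
import Data.List.Properties as List
open import Data.List.Relation.Unary.All as All using (All; []; _∷_)
open import Data.List.Relation.Unary.AllPairs using (AllPairs; []; _∷_)
open import Data.Product using (_,_; proj₁; proj₂; ∃-syntax) renaming (_×_ to _∧_)
open import Data.Unit.Polymorphic using (⊤)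
open import Data.Integer as ℤ using (ℤ; +_; -[1+_])
import Data.Integer.Properties as ℤₚ
open import Data.Maybe using (Maybe; just; nothing)
open import Function using (_∘_)
open import Relation.Nullary using (¬_; yes; no)
open import Relation.Binary.PropositionalEquality as ≡ using (_≡_)
open import Algebra.Bundles using (CommutativeRing; Semiring)
open import Algebra.Solver.Ring.AlmostCommutativeRing
  using (fromCommutativeRing; _-Raw-AlmostCommutative⟶_)
import Algebra.Definitions.RawSemiring as RawSemiringDefinitions
import Algebra.Properties.Ring as RingProperties
import Algebra.Properties.CommutativeSemigroup as CommutativeSemigroupProperties
import Algebra.Properties.Monoid.Mult as MonoidMultiplication
import Algebra.Properties.Monoid.Mult.TCOptimised as MonoidMultiplicationTC
import Algebra.Properties.Semiring.Mult as SemiringMultiplication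
import Algebra.Properties.Semiring.Mult.TCOptimised as SemiringMultiplicationTC
import Algebra.Properties.Semiring.Exp as SemiringExponentiation
open import Defs

module RingSolver {c ℓ} (R : CommutativeRing c ℓ) where
  open CommutativeRing R
  open MonoidMultiplicationTC +-monoid using (_×_; 1+×; ×-homo-+)
  open SemiringMultiplicationTC semiring using (×1-homo-*)
  open RingProperties ring using (-‿involutive; -0#≈0#; -‿+-comm; -‿distribˡ-*; -‿distribʳ-*)
  open CommutativeSemigroupProperties +-commutativeSemigroup using (interchange)
  open import Relation.Binary.Reasoning.Setoid setoid

  -- The optimised _×_ makes fromℤ (+ 1) reduce to 1#, so that the solver constant
  -- con (+ 1) matches 1# in goals.
  fromℤ : ℤ → Carrier
  fromℤ (+ n)      = n × 1#
  fromℤ -[1+ n ]   = - (suc n × 1#)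

  fromℤ-homo-neg : ∀ i → fromℤ (ℤ.- i) ≈ - fromℤ i
  fromℤ-homo-neg (+ zero)  = sym -0#≈0#
  fromℤ-homo-neg (+ suc n) = refl
  fromℤ-homo-neg -[1+ n ]  = sym (-‿involutive _)

  fromℤ-homo-⊖ : ∀ m n → fromℤ (m ℤ.⊖ n) ≈ m × 1# - n × 1#
  fromℤ-homo-⊖ zero    zero    = sym (-‿inverseʳ 0#)
  fromℤ-homo-⊖ zero    (suc n) = sym (+-identityˡ _)
  fromℤ-homo-⊖ (suc m) zero    = sym (trans (+-congˡ -0#≈0#) (+-identityʳ _))
  fromℤ-homo-⊖ (suc m) (suc n) = begin
    fromℤ (suc m ℤ.⊖ suc n)               ≡⟨ ≡.cong fromℤ (ℤₚ.[1+m]⊖[1+n]≡m⊖n m n) ⟩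
    fromℤ (m ℤ.⊖ n)                       ≈⟨ fromℤ-homo-⊖ m n ⟩
    m × 1# - n × 1#                       ≈⟨ +-identityˡ _ ⟨
    0# + (m × 1# - n × 1#)                ≈⟨ +-congʳ (-‿inverseʳ 1#) ⟨
    (1# - 1#) + (m × 1# - n × 1#)         ≈⟨ interchange _ _ _ _ ⟩
    (1# + m × 1#) + (- 1# - n × 1#)       ≈⟨ +-cong (1+× m 1#) (sym (-‿+-comm 1# _)) ⟨
    suc m × 1# - (1# + n × 1#)            ≈⟨ +-congˡ (-‿cong (1+× n 1#)) ⟨
    suc m × 1# - suc n × 1#               ∎

  fromℤ-homo-+ : ∀ i j → fromℤ (i ℤ.+ j) ≈ fromℤ i + fromℤ j
  fromℤ-homo-+ (+ m)     (+ n)     = ×-homo-+ 1# m n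
  fromℤ-homo-+ (+ m)     -[1+ n ]  = fromℤ-homo-⊖ m (suc n)
  fromℤ-homo-+ -[1+ m ]  (+ n)     = trans (fromℤ-homo-⊖ n (suc m)) (+-comm _ _)
  fromℤ-homo-+ -[1+ m ]  -[1+ n ]  = begin
    - (suc (suc (m ℕ.+ n)) × 1#)          ≡⟨ ≡.cong (λ k → - (suc k × 1#)) (ℕₚ.+-suc m n) ⟨
    - ((suc m ℕ.+ suc n) × 1#)            ≈⟨ -‿cong (×-homo-+ 1# (suc m) (suc n)) ⟩
    - (suc m × 1# + suc n × 1#)           ≈⟨ -‿+-comm _ _ ⟨
    - (suc m × 1#) + - (suc n × 1#)       ∎

  fromℤ-homo-*⁺ : ∀ m j → fromℤ (+ m ℤ.* j) ≈ fromℤ (+ m) * fromℤ j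
  fromℤ-homo-*⁺ m (+ n)    = trans (reflexive (≡.cong fromℤ (≡.sym (ℤₚ.pos-* m n)))) (×1-homo-* m n)
  fromℤ-homo-*⁺ m -[1+ n ] = begin
    fromℤ (+ m ℤ.* ℤ.- (+ suc n))       ≡⟨ ≡.cong fromℤ (ℤₚ.neg-distribʳ-* (+ m) (+ suc n)) ⟨
    fromℤ (ℤ.- (+ m ℤ.* + suc n))       ≈⟨ fromℤ-homo-neg (+ m ℤ.* + suc n) ⟩
    - fromℤ (+ m ℤ.* + suc n)           ≈⟨ -‿cong (fromℤ-homo-*⁺ m (+ suc n)) ⟩
    - (fromℤ (+ m) * fromℤ (+ suc n))   ≈⟨ -‿distribʳ-* _ _ ⟩
    fromℤ (+ m) * fromℤ -[1+ n ]        ∎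

  fromℤ-homo-* : ∀ i j → fromℤ (i ℤ.* j) ≈ fromℤ i * fromℤ j
  fromℤ-homo-* (+ m)    j = fromℤ-homo-*⁺ m j
  fromℤ-homo-* -[1+ m ] j = begin
    fromℤ (ℤ.- (+ suc m) ℤ.* j)     ≡⟨ ≡.cong fromℤ (ℤₚ.neg-distribˡ-* (+ suc m) j) ⟨
    fromℤ (ℤ.- (+ suc m ℤ.* j))     ≈⟨ fromℤ-homo-neg (+ suc m ℤ.* j) ⟩
    - fromℤ (+ suc m ℤ.* j)         ≈⟨ -‿cong (fromℤ-homo-*⁺ (suc m) j) ⟩
    - (fromℤ (+ suc m) * fromℤ j)   ≈⟨ -‿distribˡ-* _ _ ⟩
    fromℤ -[1+ m ] * fromℤ j        ∎

  private
    A = fromCommutativeRing R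

    homomorphism : ℤ.+-*-rawRing -Raw-AlmostCommutative⟶ A
    homomorphism = record
      { ⟦_⟧    = fromℤ
      ; +-homo = fromℤ-homo-+
      ; *-homo = fromℤ-homo-*
      ; -‿homo = fromℤ-homo-neg
      ; 0-homo = refl
      ; 1-homo = refl
      }

    fromℤ-weaklyDecidable : ∀ i j → Maybe (fromℤ i ≈ fromℤ j)
    fromℤ-weaklyDecidable i j with i ℤ.≟ j
    ... | yes i≡j = just (reflexive (≡.cong fromℤ i≡j))
    ... | no  _   = nothing

  open import Algebra.Solver.Ring ℤ.+-*-rawRing A homomorphism fromℤ-weaklyDecidable public

module RangeSums {c ℓ} (R : CommutativeRing c ℓ) where
  open CommutativeRing R
  open RawSemiringDefinitions (Semiring.rawSemiring semiring) using (_×_; _^_)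
  open RingSolver R
  open import Relation.Binary.Reasoning.Setoid setoid

  ∑ ∏ : (ℕ → Carrier) → ℕ → ℕ → Carrier
  ∑ f st zero    = 0#
  ∑ f st (suc k) = f st + ∑ f (suc st) k
  ∏ f st zero    = 1#
  ∏ f st (suc k) = f st * ∏ f (suc st) k

  ∑-split : ∀ f st j k → ∑ f st (j ℕ.+ k) ≈ ∑ f st j + ∑ f (st ℕ.+ j) k
  ∑-split f st zero    k rewrite ℕₚ.+-identityʳ st = sym (+-identityˡ _)
  ∑-split f st (suc j) k rewrite ℕₚ.+-suc st j =
    trans (+-congˡ (∑-split f (suc st) j k)) (sym (+-assoc _ _ _))

  ∑[1-f]≈k-∑f : ∀ f st k → ∑ (λ i → 1# - f i) st k ≈ k × 1# - ∑ f st k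
  ∑[1-f]≈k-∑f f st zero    = sym (-‿inverseʳ 0#)
  ∑[1-f]≈k-∑f f st (suc k) = begin
    (1# - f st) + ∑ (λ i → 1# - f i) (suc st) k
      ≈⟨ +-congˡ (∑[1-f]≈k-∑f f (suc st) k) ⟩
    (1# - f st) + (k × 1# - ∑ f (suc st) k)
      ≈⟨ solve 3 (λ a b c → (con (+ 1) :- a) :+ (b :- c) := (con (+ 1) :+ b) :- (a :+ c)) refl _ _ _ ⟩
    (1# + k × 1#) - (f st + ∑ f (suc st) k)  ∎

  1#^k≈1# : ∀ k → 1# ^ k ≈ 1#
  1#^k≈1# zero    = refl
  1#^k≈1# (suc k) = trans (*-identityˡ _) (1#^k≈1# k)

  ∑-pow-1# : ∀ st k → ∑ (1# ^_) st k ≈ k × 1#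
  ∑-pow-1# st zero    = refl
  ∑-pow-1# st (suc k) = +-cong (1#^k≈1# st) (∑-pow-1# (suc st) k)

  ∑-pow-suc : ∀ x st k → ∑ (x ^_) (suc st) k ≈ x * ∑ (x ^_) st k
  ∑-pow-suc x st zero    = sym (zeroʳ x)
  ∑-pow-suc x st (suc k) = trans (+-congˡ (∑-pow-suc x (suc st) k)) (sym (distribˡ x _ _))

  ∑-pow-telescope : ∀ x st k → (1# - x) * ∑ (x ^_) st k ≈ x ^ st - x ^ (st ℕ.+ k)
  ∑-pow-telescope x st zero rewrite ℕₚ.+-identityʳ st =
    solve 2 (λ x p → (con (+ 1) :- x) :* con (+ 0) := p :- p) refl x (x ^ st)
  ∑-pow-telescope x st (suc k) rewrite ℕₚ.+-suc st k = begin
    (1# - x) * (x ^ st + ∑ (x ^_) (suc st) k)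
      ≈⟨ distribˡ _ _ _ ⟩
    (1# - x) * x ^ st + (1# - x) * ∑ (x ^_) (suc st) k
      ≈⟨ +-congˡ (∑-pow-telescope x (suc st) k) ⟩
    (1# - x) * x ^ st + (x * x ^ st - x ^ suc (st ℕ.+ k))
      ≈⟨ solve 3 (λ x p q → (con (+ 1) :- x) :* p :+ (x :* p :- q) := p :- q) refl x (x ^ st) _ ⟩
    x ^ st - x ^ suc (st ℕ.+ k)  ∎

module FieldProperties {c ℓ} (F : Field c ℓ) where
  open Field F
  open RingProperties ring using (x∙y⁻¹≈ε⇒x≈y; x[y-z]≈xy-xz)
  open RingSolver commutativeRing
  open import Relation.Binary.Reasoning.Setoid setoid

  ⁻¹-inverseˡ : ∀ x → ¬ x ≈ 0# → x ⁻¹ * x ≈ 1#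
  ⁻¹-inverseˡ x x≉0 = trans (*-comm _ _) (⁻¹-inverse x x≉0)

  x≉0∧x*y≈0⇒y≈0 : ∀ {x y} → ¬ x ≈ 0# → x * y ≈ 0# → y ≈ 0#
  x≉0∧x*y≈0⇒y≈0 {x} {y} x≉0 x*y≈0 = begin
    y               ≈⟨ *-identityˡ y ⟨
    1# * y          ≈⟨ *-congʳ (⁻¹-inverseˡ x x≉0) ⟨
    x ⁻¹ * x * y    ≈⟨ *-assoc _ _ _ ⟩
    x ⁻¹ * (x * y)  ≈⟨ *-congˡ x*y≈0 ⟩
    x ⁻¹ * 0#       ≈⟨ zeroʳ _ ⟩
    0#              ∎

  x≉0∧y≉0⇒x*y≉0 : ∀ {x y} → ¬ x ≈ 0# → ¬ y ≈ 0# → ¬ x * y ≈ 0#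
  x≉0∧y≉0⇒x*y≉0 x≉0 y≉0 = y≉0 ∘ x≉0∧x*y≈0⇒y≈0 x≉0

  x-y≈0⇒x≈y : ∀ {x y} → x - y ≈ 0# → x ≈ y
  x-y≈0⇒x≈y = x∙y⁻¹≈ε⇒x≈y _ _

  *-cancelˡ : ∀ {x y z} → ¬ x ≈ 0# → x * y ≈ x * z → y ≈ z
  *-cancelˡ {x} {y} {z} x≉0 x*y≈x*z = x-y≈0⇒x≈y (x≉0∧x*y≈0⇒y≈0 x≉0 (begin
    x * (y - z)        ≈⟨ x[y-z]≈xy-xz x y z ⟩
    x * y - x * z      ≈⟨ +-congʳ x*y≈x*z ⟩
    x * z - x * z      ≈⟨ -‿inverseʳ _ ⟩
    0#                 ∎))

  ⁻¹-sub : ∀ {x y} → ¬ x ≈ 0# → ¬ y ≈ 0# → x ⁻¹ - y ⁻¹ ≈ x ⁻¹ * y ⁻¹ * (y - x)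
  ⁻¹-sub {x} {y} x≉0 y≉0 = begin
    x ⁻¹ - y ⁻¹
      ≈⟨ +-cong (*-identityʳ _) (-‿cong (*-identityʳ _)) ⟨
    x ⁻¹ * 1# - y ⁻¹ * 1#
      ≈⟨ +-cong (*-congˡ (⁻¹-inverseˡ y y≉0)) (-‿cong (*-congˡ (⁻¹-inverseˡ x x≉0))) ⟨
    x ⁻¹ * (y ⁻¹ * y) - y ⁻¹ * (x ⁻¹ * x)
      ≈⟨ solve 4 (λ x' y' x y → x' :* (y' :* y) :- y' :* (x' :* x)
                  := x' :* y' :* (y :- x)) refl (x ⁻¹) (y ⁻¹) x y ⟩
    x ⁻¹ * y ⁻¹ * (y - x)  ∎

  x*y≈1⇒x⁻¹≈y : ∀ {x y} → x * y ≈ 1# → x ⁻¹ ≈ y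
  x*y≈1⇒x⁻¹≈y {x} {y} x*y≈1 = begin
    x ⁻¹              ≈⟨ *-identityʳ _ ⟨
    x ⁻¹ * 1#         ≈⟨ *-congˡ x*y≈1 ⟨
    x ⁻¹ * (x * y)    ≈⟨ *-assoc _ _ _ ⟨
    x ⁻¹ * x * y      ≈⟨ *-congʳ (⁻¹-inverseˡ x x≉0) ⟩
    1# * y            ≈⟨ *-identityˡ y ⟩
    y                 ∎
    where
    x≉0 : ¬ x ≈ 0#
    x≉0 x≈0 = 0≉1 (trans (sym (zeroˡ y)) (trans (*-congʳ (sym x≈0)) x*y≈1))

  x*y≈1∧w≈y*z⇒z*w⁻¹≈x : ∀ {x y z w} → ¬ w ≈ 0# → w ≈ y * z → x * y ≈ 1# → z * w ⁻¹ ≈ x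
  x*y≈1∧w≈y*z⇒z*w⁻¹≈x {x} {y} {z} {w} w≉0 w≈y*z x*y≈1 = begin
    z * w ⁻¹
      ≈⟨ *-identityˡ _ ⟨
    1# * (z * w ⁻¹)
      ≈⟨ *-congʳ x*y≈1 ⟨
    x * y * (z * w ⁻¹)
      ≈⟨ solve 4 (λ x y z w′ → x :* y :* (z :* w′) := x :* (y :* z :* w′)) refl x y z (w ⁻¹) ⟩
    x * (y * z * w ⁻¹)
      ≈⟨ *-congˡ (*-congʳ w≈y*z) ⟨
    x * (w * w ⁻¹)
      ≈⟨ *-congˡ (⁻¹-inverse w w≉0) ⟩
    x * 1#
      ≈⟨ *-identityʳ x ⟩
    x  ∎

module Polynomials {c ℓ} (F : Field c ℓ) where
  open Field F
  open FieldProperties F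
  open RangeSums commutativeRing using (∑; ∑-pow-suc)
  open RingProperties ring using (x≈y⇒x∙y⁻¹≈ε; -0#≈0#)
  open RingSolver commutativeRing
  open import Relation.Binary.Reasoning.Setoid setoid

  -- f is a polynomial function of degree at most d whose coefficient of t ^ d is lc.
  IsPoly : ℕ → Carrier → (Carrier → Carrier) → Set (c ⊔ ℓ)
  IsPoly zero    lc f = ∀ t → f t ≈ lc
  IsPoly (suc d) lc f = ∃[ a ] ∃[ g ] IsPoly d lc g ∧ (∀ t → f t ≈ a + t * g t)

  IsPoly-scale : ∀ d {lc f} r → IsPoly d lc f → IsPoly d (r * lc) (λ t → r * f t)
  IsPoly-scale zero    r f≈lc                = λ t → *-congˡ (f≈lc t)
  IsPoly-scale (suc d) {f = f} r (a , g , g-poly , f≈) =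
    r * a , (λ t → r * g t) , IsPoly-scale d r g-poly , λ t → begin
    r * f t
      ≈⟨ *-congˡ (f≈ t) ⟩
    r * (a + t * g t)
      ≈⟨ solve 4 (λ r a t g → r :* (a :+ t :* g) := r :* a :+ t :* (r :* g)) refl r a t (g t) ⟩
    r * a + t * (r * g t)  ∎

  IsPoly-+-lower : ∀ d {lc lc′ f h} → IsPoly (suc d) lc f → IsPoly d lc′ h →
                   IsPoly (suc d) lc (λ t → f t + h t)
  IsPoly-+-lower zero {lc′ = lc′} {f} {h} (a , g , g-poly , f≈) h≈lc′ =
    a + lc′ , g , g-poly , λ t → begin
    f t + h t              ≈⟨ +-cong (f≈ t) (h≈lc′ t) ⟩
    a + t * g t + lc′      ≈⟨ solve 3 (λ a x b → a :+ x :+ b := a :+ b :+ x) refl a (t * g t) lc′ ⟩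
    a + lc′ + t * g t      ∎
  IsPoly-+-lower (suc d) {f = f} {h = h} (a , g , g-poly , f≈) (b , k , k-poly , h≈) =
    a + b , (λ t → g t + k t) , IsPoly-+-lower d g-poly k-poly , λ t → begin
    f t + h t
      ≈⟨ +-cong (f≈ t) (h≈ t) ⟩
    a + t * g t + (b + t * k t)
      ≈⟨ solve 5 (λ a b t g k → a :+ t :* g :+ (b :+ t :* k)
                  := a :+ b :+ t :* (g :+ k)) refl a b t (g t) (k t) ⟩
    a + b + t * (g t + k t)  ∎

  tail-difference : ∀ {f g : Carrier → Carrier} a → (∀ t → f t ≈ a + t * g t) →
                    ∀ r t → f t - f r ≈ (t - r) * g t + r * (g t - g r)
  tail-difference {f} {g} a f≈ r t = begin
    f t - f r
      ≈⟨ +-cong (f≈ t) (-‿cong (f≈ r)) ⟩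
    a + t * g t - (a + r * g r)
      ≈⟨ solve 5 (λ a t r g g′ → a :+ t :* g :- (a :+ r :* g′)
                  := (t :- r) :* g :+ r :* (g :- g′)) refl a t r (g t) (g r) ⟩
    (t - r) * g t + r * (g t - g r)  ∎

  divided-difference : ∀ d {lc f} → IsPoly (suc d) lc f → ∀ r →
    ∃[ q ] IsPoly d lc q ∧ (∀ t → f t - f r ≈ (t - r) * q t)
  divided-difference zero {f = f} (a , g , g≈lc , f≈) r = g , g≈lc , λ t → begin
    f t - f r
      ≈⟨ tail-difference a f≈ r t ⟩
    (t - r) * g t + r * (g t - g r)
      ≈⟨ +-congˡ (*-congˡ (x≈y⇒x∙y⁻¹≈ε (trans (g≈lc t) (sym (g≈lc r))))) ⟩
    (t - r) * g t + r * 0#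
      ≈⟨ solve 3 (λ t r g → (t :- r) :* g :+ r :* con (+ 0) := (t :- r) :* g) refl t r (g t) ⟩
    (t - r) * g t  ∎
  divided-difference (suc d) {f = f} (a , g , g-poly , f≈) r with divided-difference d g-poly r
  ... | q , q-poly , g-diff =
    (λ t → g t + r * q t) , IsPoly-+-lower d g-poly (IsPoly-scale d r q-poly) , λ t → begin
    f t - f r
      ≈⟨ tail-difference a f≈ r t ⟩
    (t - r) * g t + r * (g t - g r)
      ≈⟨ +-congˡ (*-congˡ (g-diff t)) ⟩
    (t - r) * g t + r * ((t - r) * q t)
      ≈⟨ solve 4 (λ t r g q → (t :- r) :* g :+ r :* ((t :- r) :* q)
                  := (t :- r) :* (g :+ r :* q)) refl t r (g t) (q t) ⟩
    (t - r) * (g t + r * q t)  ∎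

  factor-root : ∀ d {lc f r} → IsPoly (suc d) lc f → f r ≈ 0# →
    ∃[ q ] IsPoly d lc q ∧ (∀ t → f t ≈ (t - r) * q t)
  factor-root d {f = f} {r} f-poly fr≈0 with divided-difference d f-poly r
  ... | q , q-poly , f-diff = q , q-poly , λ t → begin
    f t             ≈⟨ +-identityʳ _ ⟨
    f t + 0#        ≈⟨ +-congˡ (trans (-‿cong fr≈0) -0#≈0#) ⟨
    f t - f r       ≈⟨ f-diff t ⟩
    (t - r) * q t   ∎

  monicWithRoots : List Carrier → Carrier → Carrier
  monicWithRoots []       t = 1#
  monicWithRoots (r ∷ rs) t = (t - r) * monicWithRoots rs t

  factor-roots : ∀ rs d {lc f} → IsPoly (length rs ℕ.+ d) lc f →
    All (λ r → f r ≈ 0#) rs → AllPairs (λ r s → ¬ r ≈ s) rs →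
    ∃[ g ] IsPoly d lc g ∧ (∀ t → f t ≈ monicWithRoots rs t * g t)
  factor-roots []       d {f = f} f-poly [] [] = f , f-poly , λ t → sym (*-identityˡ _)
  factor-roots (r ∷ rs) d {f = f} f-poly (fr≈0 ∷ frs≈0) (r≉rs ∷ rs-distinct)
    with factor-root (length rs ℕ.+ d) f-poly fr≈0
  ... | q , q-poly , f≈ with factor-roots rs d q-poly (All.zipWith q-root (r≉rs , frs≈0)) rs-distinct
    where
    q-root : ∀ {s} → ¬ r ≈ s ∧ f s ≈ 0# → q s ≈ 0#
    q-root {s} (r≉s , fs≈0) =
      x≉0∧x*y≈0⇒y≈0 (r≉s ∘ sym ∘ x-y≈0⇒x≈y) (trans (sym (f≈ s)) fs≈0)
  ... | g , g-poly , q≈ = g , g-poly , λ t → begin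
    f t                                     ≈⟨ f≈ t ⟩
    (t - r) * q t                           ≈⟨ *-congˡ (q≈ t) ⟩
    (t - r) * (monicWithRoots rs t * g t)   ≈⟨ *-assoc _ _ _ ⟨
    monicWithRoots (r ∷ rs) t * g t         ∎

  IsPoly-geometric : ∀ k → IsPoly k 1# (λ t → ∑ (t ^_) 0 (suc k))
  IsPoly-geometric zero    = λ t → +-identityʳ 1#
  IsPoly-geometric (suc k) =
    1# , (λ t → ∑ (t ^_) 0 (suc k)) , IsPoly-geometric k , λ t → +-congˡ (∑-pow-suc t 0 (suc k))

module Powers {c ℓ} (F : Field c ℓ) (ζ : Field.Carrier F) where
  open Field F
  open RangeSums commutativeRing
  open Polynomials F using (monicWithRoots)
  open RingSolver commutativeRing
  open import Relation.Binary.Reasoning.Setoid setoid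

  u y : ℕ → Carrier
  u i = 1# - ζ ^ i
  y i = u i ⁻¹

  InvertibleOn : ℕ → ℕ → Set ℓ
  InvertibleOn st zero    = ⊤
  InvertibleOn st (suc k) = y st * u st ≈ 1# ∧ InvertibleOn (suc st) k

  powers : ℕ → ℕ → List Carrier
  powers st zero    = []
  powers st (suc k) = ζ ^ st ∷ powers (suc st) k

  length-powers : ∀ st k → length (powers st k) ≡ k
  length-powers st zero    = ≡.refl
  length-powers st (suc k) = ≡.cong suc (length-powers (suc st) k)

  ∏y*∏u≈1 : ∀ st k → InvertibleOn st k → ∏ y st k * monicWithRoots (powers st k) 1# ≈ 1#
  ∏y*∏u≈1 st zero    _             = *-identityʳ 1#
  ∏y*∏u≈1 st (suc k) (yu≈1 , inv) = begin
    y st * ∏ y (suc st) k * (u st * M)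
      ≈⟨ solve 4 (λ a b c d → a :* b :* (c :* d) := a :* c :* (b :* d)) refl _ _ _ _ ⟩
    y st * u st * (∏ y (suc st) k * M)
      ≈⟨ *-cong yu≈1 (∏y*∏u≈1 (suc st) k inv) ⟩
    1# * 1#
      ≈⟨ *-identityʳ 1# ⟩
    1#  ∎
    where M = monicWithRoots (powers (suc st) k) 1#

  oneTwoOne : ℕ → ℕ → List ℕ
  oneTwoOne a b = replicate a 1 ++ 2 ∷ replicate b 1

  length-oneTwoOne : ∀ a b → length (oneTwoOne a b) ≡ suc (a ℕ.+ b)
  length-oneTwoOne zero    b = ≡.cong suc (List.length-replicate b)
  length-oneTwoOne (suc a) b = ≡.cong suc (length-oneTwoOne a b)

  Zgo-tooFewIndices : ∀ st cnt s ss → cnt ≤ length ss → Zgo ζ st cnt (s ∷ ss) ≈ 0#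
  Zgo-tooFewIndices st zero      s ss        _          = refl
  Zgo-tooFewIndices st (suc cnt) s (s′ ∷ ss) (s≤s cnt≤) = begin
    y st ^ s * Zgo ζ (suc st) cnt (s′ ∷ ss) + Zgo ζ (suc st) cnt (s ∷ s′ ∷ ss)
      ≈⟨ +-cong (*-congˡ (Zgo-tooFewIndices (suc st) cnt s′ ss cnt≤))
                (Zgo-tooFewIndices (suc st) cnt s (s′ ∷ ss) (ℕₚ.m≤n⇒m≤1+n cnt≤)) ⟩
    y st ^ s * 0# + 0#
      ≈⟨ trans (+-identityʳ _) (zeroʳ _) ⟩
    0#  ∎

  Zgo-exact-cons : ∀ st s ss {cnt} → cnt ≡ length ss →
                   Zgo ζ st (suc cnt) (s ∷ ss) ≈ y st ^ s * Zgo ζ (suc st) cnt ss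
  Zgo-exact-cons st s ss cnt≡ =
    trans (+-congˡ (Zgo-tooFewIndices (suc st) _ s ss (ℕₚ.≤-reflexive cnt≡))) (+-identityʳ _)

  Zgo-ones : ∀ st k → Zgo ζ st k (replicate k 1) ≈ ∏ y st k
  Zgo-ones st zero    = refl
  Zgo-ones st (suc k) = begin
    Zgo ζ st (suc k) (1 ∷ replicate k 1)
      ≈⟨ Zgo-exact-cons st 1 _ (≡.sym (List.length-replicate k)) ⟩
    y st ^ 1 * Zgo ζ (suc st) k (replicate k 1)
      ≈⟨ *-cong (*-identityʳ _) (Zgo-ones (suc st) k) ⟩
    y st * ∏ y (suc st) k  ∎

  Zgo-oneTwoOne : ∀ st a b →
    Zgo ζ st (suc (a ℕ.+ b)) (oneTwoOne a b) ≈ ∏ y st (suc (a ℕ.+ b)) * y (st ℕ.+ a)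
  Zgo-oneTwoOne st zero b rewrite ℕₚ.+-identityʳ st = begin
    Zgo ζ st (suc b) (2 ∷ replicate b 1)
      ≈⟨ Zgo-exact-cons st 2 _ (≡.sym (List.length-replicate b)) ⟩
    y st ^ 2 * Zgo ζ (suc st) b (replicate b 1)
      ≈⟨ *-congˡ (Zgo-ones (suc st) b) ⟩
    y st ^ 2 * ∏ y (suc st) b
      ≈⟨ solve 2 (λ y p → y :* (y :* con (+ 1)) :* p := y :* p :* y) refl (y st) _ ⟩
    y st * ∏ y (suc st) b * y st  ∎
  Zgo-oneTwoOne st (suc a) b rewrite ℕₚ.+-suc st a = begin
    Zgo ζ st (suc (suc (a ℕ.+ b))) (1 ∷ oneTwoOne a b)
      ≈⟨ Zgo-exact-cons st 1 (oneTwoOne a b) (≡.sym (length-oneTwoOne a b)) ⟩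
    y st ^ 1 * Zgo ζ (suc st) (suc (a ℕ.+ b)) (oneTwoOne a b)
      ≈⟨ *-congˡ (Zgo-oneTwoOne (suc st) a b) ⟩
    y st ^ 1 * (Q * y (suc st ℕ.+ a))
      ≈⟨ solve 3 (λ y q y′ → y :* con (+ 1) :* (q :* y′) := y :* q :* y′) refl (y st) Q _ ⟩
    y st * Q * y (suc (st ℕ.+ a))  ∎
    where Q = ∏ y (suc st) (suc (a ℕ.+ b))

  unit-expand : ∀ i → y i * u i ≈ 1# → ∀ x → x ≈ y i * u i * x
  unit-expand i yu≈1 x = sym (trans (*-congʳ yu≈1) (*-identityˡ x))

  Zgo-ones-gap : ∀ st k → InvertibleOn st (suc k) →
                 Zgo ζ st (suc k) (replicate k 1) ≈ ∏ y st (suc k) * ∑ u st (suc k)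
  Zgo-ones-gap st zero    (yu≈1 , _) = begin
    1#
      ≈⟨ yu≈1 ⟨
    y st * u st
      ≈⟨ solve 2 (λ y u → y :* u := y :* con (+ 1) :* (u :+ con (+ 0))) refl (y st) (u st) ⟩
    y st * 1# * (u st + 0#)  ∎
  Zgo-ones-gap st (suc k) (yu≈1 , inv) = begin
    y st ^ 1 * Zgo ζ (suc st) (suc k) (replicate k 1) + Zgo ζ (suc st) (suc k) (1 ∷ replicate k 1)
      ≈⟨ +-cong (*-congˡ (Zgo-ones-gap (suc st) k inv)) (Zgo-ones (suc st) (suc k)) ⟩
    y st ^ 1 * (Q * S) + Q
      ≈⟨ +-congˡ (unit-expand st yu≈1 Q) ⟩
    y st ^ 1 * (Q * S) + y st * u st * Q
      ≈⟨ solve 4 (λ y u q s → y :* con (+ 1) :* (q :* s) :+ y :* u :* q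
                  := y :* q :* (u :+ s)) refl (y st) (u st) Q S ⟩
    y st * Q * (u st + S)  ∎
    where
    Q = ∏ y (suc st) (suc k)
    S = ∑ u (suc st) (suc k)

  Zgo-oneTwoOne-gap : ∀ st a b → InvertibleOn st (suc (suc (a ℕ.+ b))) →
    Zgo ζ st (suc (suc (a ℕ.+ b))) (oneTwoOne a b) ≈
      ∏ y st (suc (suc (a ℕ.+ b))) *
        (y (st ℕ.+ a) * ∑ u (suc (st ℕ.+ a)) (suc b) + y (suc (st ℕ.+ a)) * ∑ u st (suc a))
  Zgo-oneTwoOne-gap st zero b (yu≈1 , inv) rewrite ℕₚ.+-identityʳ st = begin
    y st ^ 2 * Zgo ζ (suc st) (suc b) (replicate b 1) + Zgo ζ (suc st) (suc b) (2 ∷ replicate b 1)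
      ≈⟨ +-cong (*-congˡ (Zgo-ones-gap (suc st) b inv)) (Zgo-oneTwoOne (suc st) 0 b) ⟩
    y st ^ 2 * (Q * S) + Q * y (suc (st ℕ.+ 0))
      ≈⟨ +-congˡ (*-cong (unit-expand st yu≈1 Q) (reflexive (≡.cong (y ∘ suc) (ℕₚ.+-identityʳ st)))) ⟩
    y st ^ 2 * (Q * S) + y st * u st * Q * y (suc st)
      ≈⟨ solve 5 (λ y u q s y′ → y :* (y :* con (+ 1)) :* (q :* s) :+ y :* u :* q :* y′
                  := y :* q :* (y :* s :+ y′ :* (u :+ con (+ 0)))) refl (y st) (u st) Q S (y (suc st)) ⟩
    y st * Q * (y st * S + y (suc st) * (u st + 0#))  ∎
    where
    Q = ∏ y (suc st) (suc b)
    S = ∑ u (suc st) (suc b)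
  Zgo-oneTwoOne-gap st (suc a) b (yu≈1 , inv) rewrite ℕₚ.+-suc st a = begin
    y st ^ 1 * Zgo ζ (suc st) (suc (suc (a ℕ.+ b))) (oneTwoOne a b)
      + Zgo ζ (suc st) (suc (suc (a ℕ.+ b))) (1 ∷ oneTwoOne a b)
      ≈⟨ +-cong (*-congˡ (Zgo-oneTwoOne-gap (suc st) a b inv)) (Zgo-oneTwoOne (suc st) (suc a) b) ⟩
    y st ^ 1 * (Q * (Y₁ * A + Y₂ * B)) + Q * y (suc (st ℕ.+ suc a))
      ≈⟨ +-congˡ (*-cong (unit-expand st yu≈1 Q) (reflexive (≡.cong (y ∘ suc) (ℕₚ.+-suc st a)))) ⟩
    y st ^ 1 * (Q * (Y₁ * A + Y₂ * B)) + y st * u st * Q * Y₂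
      ≈⟨ solve 7 (λ y u q y₁ a y₂ b → y :* con (+ 1) :* (q :* (y₁ :* a :+ y₂ :* b)) :+ y :* u :* q :* y₂
                  := y :* q :* (y₁ :* a :+ y₂ :* (u :+ b))) refl (y st) (u st) Q Y₁ A Y₂ B ⟩
    y st * Q * (Y₁ * A + Y₂ * (u st + B))  ∎
    where
    Q  = ∏ y (suc st) (suc (suc (a ℕ.+ b)))
    Y₁ = y (suc (st ℕ.+ a))
    Y₂ = y (suc (suc (st ℕ.+ a)))
    A  = ∑ u (suc (suc (st ℕ.+ a))) (suc b)
    B  = ∑ u (suc st) (suc a)

m+[1+n]≤o⇒1+m+n≤o : ∀ {m n o} → m ℕ.+ suc n ≤ o → suc m ℕ.+ n ≤ o
m+[1+n]≤o⇒1+m+n≤o {m} {n} {o} = ≡.subst (_≤ o) (ℕₚ.+-suc m n)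

m+[1+n]≤o⇒m<o : ∀ {m n o} → m ℕ.+ suc n ≤ o → m < o
m+[1+n]≤o⇒m<o {m} = ℕₚ.m+n≤o⇒m≤o (suc m) ∘ m+[1+n]≤o⇒1+m+n≤o

module RootOfUnity {c ℓ} (F : Field c ℓ) (N : ℕ) (ζ : Field.Carrier F)
                     (prim : Field.PrimitiveRoot F (suc N) ζ) where
  open Field F
  open FieldProperties F
  open RangeSums commutativeRing
  open Polynomials F
  open Powers F ζ
  open MonoidMultiplication +-monoid using (×-homo-+)
  open SemiringExponentiation semiring using (^-homo-*; ^-assocʳ; ^-congˡ)
  open RingSolver commutativeRing
  open import Relation.Binary.Reasoning.Setoid setoid

  n : ℕ
  n = suc N

  ζ^n≈1 : ζ ^ n ≈ 1#
  ζ^n≈1 = proj₁ prim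

  ζ^k≉1 : ∀ {k} → 0 < k → k < n → ¬ ζ ^ k ≈ 1#
  ζ^k≉1 = proj₂ prim _

  ζ≉0 : ¬ ζ ≈ 0#
  ζ≉0 ζ≈0 = 0≉1 (begin
    0#          ≈⟨ zeroˡ (ζ ^ N) ⟨
    0# * ζ ^ N  ≈⟨ *-congʳ ζ≈0 ⟨
    ζ ^ n       ≈⟨ ζ^n≈1 ⟩
    1#          ∎)

  ζ^k≉0 : ∀ k → ¬ ζ ^ k ≈ 0#
  ζ^k≉0 zero    = 0≉1 ∘ sym
  ζ^k≉0 (suc k) = x≉0∧y≉0⇒x*y≉0 ζ≉0 (ζ^k≉0 k)

  u≉0 : ∀ {i} → 0 < i → i < n → ¬ u i ≈ 0#
  u≉0 0<i i<n = ζ^k≉1 0<i i<n ∘ sym ∘ x-y≈0⇒x≈y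

  y*u≈1 : ∀ {i} → 0 < i → i < n → y i * u i ≈ 1#
  y*u≈1 0<i i<n = ⁻¹-inverseˡ _ (u≉0 0<i i<n)

  invertibleOn : ∀ st k → 0 < st → st ℕ.+ k ≤ n → InvertibleOn st k
  invertibleOn st zero    _    _          = _
  invertibleOn st (suc k) 0<st st+1+k≤n =
    y*u≈1 0<st (m+[1+n]≤o⇒m<o st+1+k≤n) ,
    invertibleOn (suc st) k (s≤s z≤n) (m+[1+n]≤o⇒1+m+n≤o st+1+k≤n)

  ζ^i≉ζ^j : ∀ {i j} → i < j → j < n → ¬ ζ ^ i ≈ ζ ^ j
  ζ^i≉ζ^j {i} {j} i<j j<n ζ^i≈ζ^j =
    ζ^k≉1 (ℕₚ.m<n⇒0<n∸m i<j) (ℕₚ.≤-<-trans (ℕₚ.m∸n≤m j i) j<n) (sym (*-cancelˡ (ζ^k≉0 i) (begin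
      ζ ^ i * 1#               ≈⟨ *-identityʳ _ ⟩
      ζ ^ i                    ≈⟨ ζ^i≈ζ^j ⟩
      ζ ^ j                    ≡⟨ ≡.cong (ζ ^_) (ℕₚ.m+[n∸m]≡n (ℕₚ.<⇒≤ i<j)) ⟨
      ζ ^ (i ℕ.+ (j ℕ.∸ i))    ≈⟨ ^-homo-* ζ i (j ℕ.∸ i) ⟩
      ζ ^ i * ζ ^ (j ℕ.∸ i)    ∎)))

  powers-distinct : ∀ st k → st ℕ.+ k ≤ n → AllPairs (λ r s → ¬ r ≈ s) (powers st k)
  powers-distinct st zero    _          = []
  powers-distinct st (suc k) st+1+k≤n =
    ζ^st≉later (suc st) k ℕₚ.≤-refl (m+[1+n]≤o⇒1+m+n≤o st+1+k≤n) ∷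
    powers-distinct (suc st) k (m+[1+n]≤o⇒1+m+n≤o st+1+k≤n)
    where
    ζ^st≉later : ∀ j k → st < j → j ℕ.+ k ≤ n → All (λ s → ¬ ζ ^ st ≈ s) (powers j k)
    ζ^st≉later j zero    _    _          = []
    ζ^st≉later j (suc k) st<j j+1+k≤n =
      ζ^i≉ζ^j st<j (m+[1+n]≤o⇒m<o j+1+k≤n) ∷
      ζ^st≉later (suc j) k (ℕₚ.m<n⇒m<1+n st<j) (m+[1+n]≤o⇒1+m+n≤o j+1+k≤n)

  geometric-root : ∀ {i} → 0 < i → i < n → ∑ ((ζ ^ i) ^_) 0 n ≈ 0#
  geometric-root {i} 0<i i<n = x≉0∧x*y≈0⇒y≈0 (u≉0 0<i i<n) (begin
    (1# - ζ ^ i) * ∑ ((ζ ^ i) ^_) 0 n  ≈⟨ ∑-pow-telescope (ζ ^ i) 0 n ⟩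
    1# - (ζ ^ i) ^ n                   ≈⟨ +-congˡ (-‿cong [ζ^i]^n≈1) ⟩
    1# - 1#                            ≈⟨ -‿inverseʳ 1# ⟩
    0#                                 ∎)
    where
    [ζ^i]^n≈1 : (ζ ^ i) ^ n ≈ 1#
    [ζ^i]^n≈1 = begin
      (ζ ^ i) ^ n    ≈⟨ ^-assocʳ ζ i n ⟩
      ζ ^ (i ℕ.* n)  ≡⟨ ≡.cong (ζ ^_) (ℕₚ.*-comm i n) ⟩
      ζ ^ (n ℕ.* i)  ≈⟨ ^-assocʳ ζ n i ⟨
      (ζ ^ n) ^ i    ≈⟨ ^-congˡ i ζ^n≈1 ⟩
      1# ^ i         ≈⟨ 1#^k≈1# i ⟩
      1#             ∎

  powers-geometric-roots : ∀ st k → 0 < st → st ℕ.+ k ≤ n →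
                           All (λ r → ∑ (r ^_) 0 n ≈ 0#) (powers st k)
  powers-geometric-roots st zero    _    _          = []
  powers-geometric-roots st (suc k) 0<st st+1+k≤n =
    geometric-root 0<st (m+[1+n]≤o⇒m<o st+1+k≤n) ∷
    powers-geometric-roots (suc st) k (s≤s z≤n) (m+[1+n]≤o⇒1+m+n≤o st+1+k≤n)

  ∏u≈n : monicWithRoots (powers 1 N) 1# ≈ fromℕ n
  ∏u≈n with factor-roots (powers 1 N) 0 geometric-poly
                          (powers-geometric-roots 1 N (s≤s z≤n) ℕₚ.≤-refl) (powers-distinct 1 N ℕₚ.≤-refl)
    where
    geometric-poly : IsPoly (length (powers 1 N) ℕ.+ 0) 1# (λ t → ∑ (t ^_) 0 n)
    geometric-poly = ≡.subst (λ d → IsPoly d 1# (λ t → ∑ (t ^_) 0 n))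
                             (≡.sym (≡.trans (ℕₚ.+-identityʳ _) (length-powers 1 N))) (IsPoly-geometric N)
  ... | g , g≈1 , geometric≈ = begin
    M                ≈⟨ *-identityʳ M ⟨
    M * 1#           ≈⟨ *-congˡ (g≈1 1#) ⟨
    M * g 1#         ≈⟨ geometric≈ 1# ⟨
    ∑ (1# ^_) 0 n    ≈⟨ ∑-pow-1# 0 n ⟩
    fromℕ n          ∎
    where M = monicWithRoots (powers 1 N) 1#

  ∏y*n≈1 : ∏ y 1 N * fromℕ n ≈ 1#
  ∏y*n≈1 = trans (*-congˡ (sym ∏u≈n)) (∏y*∏u≈1 1 N (invertibleOn 1 N (s≤s z≤n) ℕₚ.≤-refl))

  ∑ζ^≈-1 : 0 < N → ∑ (ζ ^_) 1 N ≈ - 1#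
  ∑ζ^≈-1 0<N = *-cancelˡ 1-ζ≉0 (begin
    (1# - ζ) * ∑ (ζ ^_) 1 N
      ≈⟨ ∑-pow-telescope ζ 1 N ⟩
    ζ ^ 1 - ζ ^ n
      ≈⟨ +-cong (*-identityʳ ζ) (-‿cong ζ^n≈1) ⟩
    ζ - 1#
      ≈⟨ solve 1 (λ z → z :- con (+ 1) := (con (+ 1) :- z) :* (:- con (+ 1))) refl ζ ⟩
    (1# - ζ) * - 1#  ∎)
    where
    1-ζ≉0 : ¬ 1# - ζ ≈ 0#
    1-ζ≉0 = u≉0 (s≤s z≤n) (s≤s 0<N) ∘ trans (+-congˡ (-‿cong (*-identityʳ ζ)))

  ∑u-complement : ∀ p q → p ℕ.+ q ≡ N → 0 < N → ∑ u (suc p) q ≈ fromℕ n - ∑ u 1 p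
  ∑u-complement p q p+q≡N 0<N = begin
    ∑ u (suc p) q                        ≈⟨ solve 2 (λ a b → b := a :+ b :- a) refl (∑ u 1 p) _ ⟩
    ∑ u 1 p + ∑ u (suc p) q - ∑ u 1 p    ≈⟨ +-congʳ total ⟩
    fromℕ n - ∑ u 1 p                    ∎
    where
    total : ∑ u 1 p + ∑ u (suc p) q ≈ fromℕ n
    total = begin
      ∑ u 1 p + ∑ u (suc p) q    ≈⟨ ∑-split u 1 p q ⟨
      ∑ u 1 (p ℕ.+ q)            ≡⟨ ≡.cong (∑ u 1) p+q≡N ⟩
      ∑ u 1 N                    ≈⟨ ∑[1-f]≈k-∑f (ζ ^_) 1 N ⟩
      fromℕ N - ∑ (ζ ^_) 1 N     ≈⟨ +-congˡ (-‿cong (∑ζ^≈-1 0<N)) ⟩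
      fromℕ N - - 1#             ≈⟨ solve 1 (λ x → x :- (:- con (+ 1)) := con (+ 1) :+ x) refl _ ⟩
      fromℕ n                    ∎

  y-reflect : ∀ {i j} → i ℕ.+ j ≡ n → 0 < i → 0 < j → y j ≈ 1# - y i
  y-reflect {i} {j} i+j≡n 0<i 0<j = begin
    y j
      ≈⟨ x*y≈1⇒x⁻¹≈y u*w≈1 ⟩
    - (ζ ^ i * y i)
      ≈⟨ solve 2 (λ y z → :- (z :* y) := y :* (con (+ 1) :- z) :- y) refl (y i) (ζ ^ i) ⟩
    y i * u i - y i
      ≈⟨ +-congʳ (y*u≈1 0<i i<n) ⟩
    1# - y i  ∎
    where
    i<n = ≡.subst (i <_) i+j≡n (ℕₚ.m<m+n i 0<j)
    ζ^j*ζ^i≈1 : ζ ^ j * ζ ^ i ≈ 1#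
    ζ^j*ζ^i≈1 = trans (sym (^-homo-* ζ j i))
                      (trans (reflexive (≡.cong (ζ ^_) (≡.trans (ℕₚ.+-comm j i) i+j≡n))) ζ^n≈1)
    u*w≈1 : u j * - (ζ ^ i * y i) ≈ 1#
    u*w≈1 = begin
      (1# - ζ ^ j) * - (ζ ^ i * y i)
        ≈⟨ solve 3 (λ a b y → (con (+ 1) :- a) :* (:- (b :* y))
                    := (a :* b :- b) :* y) refl (ζ ^ j) (ζ ^ i) (y i) ⟩
      (ζ ^ j * ζ ^ i - ζ ^ i) * y i
        ≈⟨ *-congʳ (+-congʳ ζ^j*ζ^i≈1) ⟩
      u i * y i
        ≈⟨ ⁻¹-inverse (u i) (u≉0 0<i i<n) ⟩
      1#  ∎

  ζ^p*[1-ζ]*[1+∑+∑]≈-u*u : ∀ p q → p ℕ.+ q ≡ N →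
    ζ ^ p * (1# - ζ) * (1# + ∑ (ζ ^_) 1 p + ∑ (ζ ^_) 1 q) ≈ - (u p * u (suc p))
  ζ^p*[1-ζ]*[1+∑+∑]≈-u*u p q p+q≡N = begin
    ζ ^ p * (1# - ζ) * (1# + Sp + Sq)
      ≈⟨ solve 4 (λ x z a b → x :* (con (+ 1) :- z) :* (con (+ 1) :+ a :+ b)
                  := x :* ((con (+ 1) :- z) :+ (con (+ 1) :- z) :* a :+ (con (+ 1) :- z) :* b)) refl (ζ ^ p) ζ Sp Sq ⟩
    ζ ^ p * ((1# - ζ) + (1# - ζ) * Sp + (1# - ζ) * Sq)
      ≈⟨ *-congˡ (+-cong (+-congˡ (∑-pow-telescope ζ 1 p)) (∑-pow-telescope ζ 1 q)) ⟩
    ζ ^ p * ((1# - ζ) + (ζ ^ 1 - ζ ^ suc p) + (ζ ^ 1 - ζ ^ suc q))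
      ≈⟨ solve 3 (λ x z w → x :* ((con (+ 1) :- z) :+ (z :* con (+ 1) :- z :* x) :+ (z :* con (+ 1) :- z :* w))
                  := x :+ z :* x :- x :* (z :* x) :- x :* (z :* w)) refl (ζ ^ p) ζ (ζ ^ q) ⟩
    ζ ^ p + ζ * ζ ^ p - ζ ^ p * (ζ * ζ ^ p) - ζ ^ p * ζ ^ suc q
      ≈⟨ +-congˡ (-‿cong ζ^p*ζ^[1+q]≈1) ⟩
    ζ ^ p + ζ * ζ ^ p - ζ ^ p * (ζ * ζ ^ p) - 1#
      ≈⟨ solve 2 (λ x z → x :+ z :* x :- x :* (z :* x) :- con (+ 1)
                  := :- ((con (+ 1) :- x) :* (con (+ 1) :- z :* x))) refl (ζ ^ p) ζ ⟩
    - (u p * u (suc p))  ∎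
    where
    Sp = ∑ (ζ ^_) 1 p
    Sq = ∑ (ζ ^_) 1 q
    ζ^p*ζ^[1+q]≈1 : ζ ^ p * ζ ^ suc q ≈ 1#
    ζ^p*ζ^[1+q]≈1 = trans (sym (^-homo-* ζ p (suc q)))
      (trans (reflexive (≡.cong (ζ ^_) (≡.trans (ℕₚ.+-suc p q) (≡.cong suc p+q≡N)))) ζ^n≈1)

  [y-y]*[n-∑u-∑u]≈-1 : ∀ p q → p ℕ.+ q ≡ N → 0 < p → 0 < q →
    (y p - y (suc p)) * (fromℕ n - ∑ u 1 p - ∑ u 1 q) ≈ - 1#
  [y-y]*[n-∑u-∑u]≈-1 p q p+q≡N 0<p 0<q = begin
    (y p - y (suc p)) * (fromℕ n - ∑ u 1 p - ∑ u 1 q)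
      ≈⟨ *-cong (⁻¹-sub (u≉0 0<p p<n) (u≉0 (s≤s z≤n) 1+p<n)) sum≈ ⟩
    y p * y (suc p) * (u (suc p) - u p) * (1# + Sp + Sq)
      ≈⟨ solve 6 (λ y y′ x z a b → y :* y′ :* ((con (+ 1) :- z :* x) :- (con (+ 1) :- x)) :* (con (+ 1) :+ a :+ b)
                  := y :* y′ :* (x :* (con (+ 1) :- z) :* (con (+ 1) :+ a :+ b))) refl (y p) (y (suc p)) (ζ ^ p) ζ Sp Sq ⟩
    y p * y (suc p) * (ζ ^ p * (1# - ζ) * (1# + Sp + Sq))
      ≈⟨ *-congˡ (ζ^p*[1-ζ]*[1+∑+∑]≈-u*u p q p+q≡N) ⟩
    y p * y (suc p) * - (u p * u (suc p))
      ≈⟨ solve 4 (λ y y′ u u′ → y :* y′ :* (:- (u :* u′))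
                  := :- (y :* u :* (y′ :* u′))) refl (y p) (y (suc p)) (u p) (u (suc p)) ⟩
    - (y p * u p * (y (suc p) * u (suc p)))
      ≈⟨ -‿cong (*-cong (y*u≈1 0<p p<n) (y*u≈1 (s≤s z≤n) 1+p<n)) ⟩
    - (1# * 1#)
      ≈⟨ -‿cong (*-identityʳ 1#) ⟩
    - 1#  ∎
    where
    Sp = ∑ (ζ ^_) 1 p
    Sq = ∑ (ζ ^_) 1 q
    1+p<n : suc p < n
    1+p<n = s≤s (≡.subst (p <_) p+q≡N (ℕₚ.m<m+n p 0<q))
    p<n : p < n
    p<n = ℕₚ.m<n⇒m<1+n (ℕₚ.≤-pred 1+p<n)
    sum≈ : fromℕ n - ∑ u 1 p - ∑ u 1 q ≈ 1# + Sp + Sq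
    sum≈ = begin
      fromℕ n - ∑ u 1 p - ∑ u 1 q
        ≈⟨ +-cong (+-cong (+-congˡ (trans (reflexive (≡.cong fromℕ (≡.sym p+q≡N))) (×-homo-+ 1# p q)))
                          (-‿cong (∑[1-f]≈k-∑f (ζ ^_) 1 p)))
                  (-‿cong (∑[1-f]≈k-∑f (ζ ^_) 1 q)) ⟩
      1# + (fromℕ p + fromℕ q) - (fromℕ p - Sp) - (fromℕ q - Sq)
        ≈⟨ solve 4 (λ a b s t → con (+ 1) :+ (a :+ b) :- (a :- s) :- (b :- t)
                    := con (+ 1) :+ s :+ t) refl (fromℕ p) (fromℕ q) Sp Sq ⟩
      1# + Sp + Sq  ∎

  𝔷′ : ℕ → ℕ → Carrier
  𝔷′ p q = y p * ∑ u (suc p) q + y (suc p) * ∑ u 1 p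

  𝔷′-mirror-sum : ∀ p q → p ℕ.+ q ≡ N → 0 < p → 0 < q → 𝔷′ p q + 𝔷′ q p ≈ fromℕ N
  𝔷′-mirror-sum p q p+q≡N 0<p 0<q = begin
    y p * ∑ u (suc p) q + y (suc p) * A + (y q * ∑ u (suc q) p + y (suc q) * B)
      ≈⟨ +-cong (+-congʳ (*-congˡ (∑u-complement p q p+q≡N 0<N)))
                (+-cong (*-cong (y-reflect (≡.cong suc p+q≡N) (s≤s z≤n) 0<q) (∑u-complement q p q+p≡N 0<N))
                        (*-congʳ (y-reflect (≡.trans (ℕₚ.+-suc p q) (≡.cong suc p+q≡N)) 0<p (s≤s z≤n)))) ⟩
    y p * (fromℕ n - A) + y (suc p) * A + ((1# - y (suc p)) * (fromℕ n - B) + (1# - y p) * B)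
      ≈⟨ solve 5 (λ y y′ m a b → y :* (m :- a) :+ y′ :* a :+ ((con (+ 1) :- y′) :* (m :- b) :+ (con (+ 1) :- y) :* b)
                  := m :+ (y :- y′) :* (m :- a :- b)) refl (y p) (y (suc p)) (fromℕ n) A B ⟩
    fromℕ n + (y p - y (suc p)) * (fromℕ n - A - B)
      ≈⟨ +-congˡ ([y-y]*[n-∑u-∑u]≈-1 p q p+q≡N 0<p 0<q) ⟩
    1# + fromℕ N - 1#
      ≈⟨ solve 1 (λ x → con (+ 1) :+ x :- con (+ 1) := x) refl (fromℕ N) ⟩
    fromℕ N  ∎
    where
    A = ∑ u 1 p
    B = ∑ u 1 q
    q+p≡N = ≡.trans (ℕₚ.+-comm q p) p+q≡N
    0<N = ℕₚ.<-≤-trans 0<p (≡.subst (p ≤_) p+q≡N (ℕₚ.m≤m+n p q))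

  𝔷-oneTwoOne : ∀ a b → suc (suc (a ℕ.+ b)) ≡ N →
                𝔷 n ζ (oneTwoOne a b) ≈ ∏ y 1 N * 𝔷′ (suc a) (suc b)
  𝔷-oneTwoOne a b 2+a+b≡N =
    ≡.subst (λ k → Zgo ζ 1 k (oneTwoOne a b) ≈ ∏ y 1 k * 𝔷′ (suc a) (suc b)) 2+a+b≡N
      (Zgo-oneTwoOne-gap 1 a b (invertibleOn 1 _ (s≤s z≤n) (ℕₚ.≤-reflexive (≡.cong suc 2+a+b≡N))))

  𝔷-mirror-sum : ∀ a b → suc (suc (a ℕ.+ b)) ≡ N →
    𝔷 n ζ (oneTwoOne a b) + 𝔷 n ζ (oneTwoOne b a) ≈ ∏ y 1 N * fromℕ N
  𝔷-mirror-sum a b 2+a+b≡N = begin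
    𝔷 n ζ (oneTwoOne a b) + 𝔷 n ζ (oneTwoOne b a)
      ≈⟨ +-cong (𝔷-oneTwoOne a b 2+a+b≡N)
                (𝔷-oneTwoOne b a (≡.trans (≡.cong (suc ∘ suc) (ℕₚ.+-comm b a)) 2+a+b≡N)) ⟩
    P * 𝔷′ (suc a) (suc b) + P * 𝔷′ (suc b) (suc a)
      ≈⟨ distribˡ P _ _ ⟨
    P * (𝔷′ (suc a) (suc b) + 𝔷′ (suc b) (suc a))
      ≈⟨ *-congˡ (𝔷′-mirror-sum (suc a) (suc b) (≡.trans (≡.cong suc (ℕₚ.+-suc a b)) 2+a+b≡N)
                                (s≤s z≤n) (s≤s z≤n)) ⟩
    P * fromℕ N  ∎
    where P = ∏ y 1 N

2*m+3≡[2+m]+[1+m] : ∀ m → 2 ℕ.* m ℕ.+ 3 ≡ suc (suc m) ℕ.+ suc m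
2*m+3≡[2+m]+[1+m] = solve 1 (λ m → con 2 :* m :+ con 3 := (con 2 :+ m) :+ (con 1 :+ m)) ≡.refl
  where open +-*-Solver

[1+m]Cm≡1+m : ∀ m → suc m C m ≡ suc m
[1+m]Cm≡1+m m =
  ≡.trans (nCk≡nC[n∸k] (ℕₚ.n≤1+n m)) (≡.trans (≡.cong (suc m C_) (ℕₚ.m+n∸n≡m 1 m)) (nC1≡n (suc m)))

module ClosedForm {c ℓ} (F : Field c ℓ) (char0 : Field.CharZero F) where
  open Field F
  open FieldProperties F
  open MonoidMultiplication +-monoid using (×-homo-+)
  open SemiringMultiplication semiring using (×1-homo-*)
  open RingSolver commutativeRing
  open import Relation.Binary.Reasoning.Setoid setoid

  fromℕ≉0 : ∀ k → .{{ℕ.NonZero k}} → ¬ fromℕ k ≈ 0#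
  fromℕ≉0 k = char0 (ℕ.pred k) ∘ trans (reflexive (≡.cong fromℕ (ℕₚ.suc-pred k)))

  closed-form : ∀ m {x} → x * fromℕ (suc (suc m)) ≈ 1# →
    - (fromℕ (m !) * (fromℕ (suc (suc m)) - fromℕ (2 ℕ.* m ℕ.+ 3))) * (fromℕ ((m ℕ.+ 2) !) ⁻¹)
      * fromℕ (suc m C m)
      ≈ x * fromℕ (suc m)
  closed-form m {x} x*n≈1 = begin
    - (K * (n - fromℕ (2 ℕ.* m ℕ.+ 3))) * X ⁻¹ * fromℕ (suc m C m)
      ≈⟨ *-cong (*-congʳ (-‿cong (*-congˡ (+-congˡ (-‿cong 2m+3≈n+N)))))
                (reflexive (≡.cong fromℕ ([1+m]Cm≡1+m m))) ⟩
    - (K * (n - (n + N))) * X ⁻¹ * N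
      ≈⟨ solve 4 (λ k n s x′ → :- (k :* (n :- (n :+ s))) :* x′ :* s := s :* k :* x′ :* s) refl K n N (X ⁻¹) ⟩
    N * K * X ⁻¹ * N
      ≈⟨ *-congʳ (x*y≈1∧w≈y*z⇒z*w⁻¹≈x (fromℕ≉0 ((m ℕ.+ 2) !) {{(m ℕ.+ 2) ℕₚ.!≢0}})
                                       X≈n*[N*K] x*n≈1) ⟩
    x * N  ∎
    where
    K = fromℕ (m !)
    N = fromℕ (suc m)
    n = fromℕ (suc (suc m))
    X = fromℕ ((m ℕ.+ 2) !)
    2m+3≈n+N : fromℕ (2 ℕ.* m ℕ.+ 3) ≈ n + N
    2m+3≈n+N = trans (reflexive (≡.cong fromℕ (2*m+3≡[2+m]+[1+m] m)))
                     (×-homo-+ 1# (suc (suc m)) (suc m))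
    X≈n*[N*K] : X ≈ n * (N * K)
    X≈n*[N*K] = trans (reflexive (≡.cong (fromℕ ∘ _!) (ℕₚ.+-comm m 2)))
                      (trans (×1-homo-* (suc (suc m)) (suc m ℕ.* m !)) (*-congˡ (×1-homo-* (suc m) (m !))))

n≡3+a+b : ∀ {n} a b → 4 ≤ n → a ℕ.+ b ℕ.+ 1 ≡ n ℕ.∸ 2 → n ≡ suc (suc (suc (a ℕ.+ b)))
n≡3+a+b {suc (suc n)} a b (s≤s (s≤s _)) a+b+1≡n =
  ≡.cong (suc ∘ suc) (≡.trans (≡.sym a+b+1≡n) (ℕₚ.+-comm (a ℕ.+ b) 1))

proposition3 : ∀ {c ℓ} (F : Field c ℓ) → Field.CharZero F →
    ∀ (n : ℕ) → (ζ : Field.Carrier F) → Field.PrimitiveRoot F n ζ → 4 ≤ n →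
    ∀ (a b : ℕ) → a ℕ.+ b ℕ.+ 1 ≡ n ℕ.∸ 2 →
      let open Field F
          m = n ℕ.∸ 2
      in 𝔷 n ζ (replicate a 1 ++ 2 ∷ replicate b 1) + 𝔷 n ζ (replicate b 1 ++ 2 ∷ replicate a 1)
           ≈ - (fromℕ (m !) * (fromℕ n - fromℕ (2 ℕ.* m ℕ.+ 3))) * (fromℕ ((m ℕ.+ 2) !) ⁻¹) * fromℕ ((n ℕ.∸ 1) C m)
proposition3 F char0 n ζ prim 4≤n a b a+b+1≡n-2 with n≡3+a+b a b 4≤n a+b+1≡n-2
... | ≡.refl = trans (𝔷-mirror-sum a b ≡.refl) (sym (closed-form (suc (a ℕ.+ b)) ∏y*n≈1))
  where
  open Field F using (trans; sym)
  open RootOfUnity F (suc (suc (a ℕ.+ b))) ζ prim using (𝔷-mirror-sum; ∏y*n≈1)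
  open ClosedForm F char0 using (closed-form)
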